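{- Let $p$ be a prime, $n\ge 2$, and let $L:\mathbb{F}_p^n\rightarrow\mathbb{F}_p^{n-1}$ be the linear map $L(x_1,\ldots,x_n)=(x_1+x_n,x_2+x_n,\ldots,x_{n-1}+x_n)$. Let $S_1,\ldots,S_n\subseteq\mathbb{F}_p$ with $|S_i|=k$ for all $i\in[n]$, where $k>\frac{(n-1)p}{n}$. Then $|L(S_1,\ldots,S_n)|=p^{n-1}$, i.e., $L(S_1,\ldots,S_n)=\mathbb{F}_p^{n-1}$.
   Context: $L(S_1,\ldots,S_n)$ denotes the image of $S_1\times\cdots\times S_n$ under $L$. -}

module Defs where

open import Data.Nat using (ℕ; suc; _+_; NonZero)
open import Data.Nat.DivMod using (_mod_)
open import Data.Fin using (Fin; toℕ; inject₁; fromℕ)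

𝔽 : ℕ → Set
𝔽 p = Fin p

_⊕_ : ∀ {p} .{{_ : NonZero p}} → 𝔽 p → 𝔽 p → 𝔽 p
_⊕_ {p} a b = (toℕ a + toℕ b) mod p

-- With n = suc m, L : F_p^n → F_p^(n-1),
-- L(x_1,…,x_n) = (x_1 + x_n, …, x_{n-1} + x_n).
-- Coordinates x_1..x_{n-1} are indices inject₁ i (i : Fin m); x_n is index fromℕ m.
L : ∀ {p} .{{_ : NonZero p}} (m : ℕ) → (Fin (suc m) → 𝔽 p) → (Fin m → 𝔽 p)
L m x i = x (inject₁ i) ⊕ x (fromℕ m)

-- The candidates for a preimage of y are the p points fibre y t = (y₁ − t, …, y_m − t, t),
-- one for each last coordinate t.  For every coordinate i the map t ↦ (fibre y t)ᵢ permutes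
-- 𝔽ₚ, so exactly k of the candidates have their i-th coordinate in Sᵢ.  Counting the
-- incidences (t, i) with (fibre y t)ᵢ ∈ Sᵢ gives (m + 1) k > m p, so some t has all m + 1
-- coordinates in the right sets.
module Submission where

open import Defs
open import Data.Bool using (Bool; true; false)
open import Data.Bool.Properties using (_≟_)
open import Data.Fin as Fin using (Fin; toℕ; inject₁; fromℕ)
open import Data.Fin.Permutation using (Permutation′; permutation; id; _⟨$⟩ʳ_)
open import Data.Fin.Properties using (toℕ-injective; toℕ-fromℕ<; toℕ<n; any?; all?)
open import Data.Fin.Relation.Unary.Top using (view; ‵fromℕ; ‵inject₁; view-fromℕ; view-inject₁)
open import Data.Fin.Subset using (Subset; _∈_; ∣_∣)
open import Data.Nat using (ℕ; zero; suc; _+_; _*_; _∸_; _<_; _≤_; z≤n; s≤s; s≤s⁻¹; NonZero)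
open import Data.Nat.DivMod using (_%_; _mod_; %-distribˡ-+; m%n%n≡m%n; [m+n]%n≡m%n; m<n⇒m%n≡m; m%n<n)
open import Data.Nat.Primality using (Prime)
open import Data.Nat.Properties
  using (+-0-commutativeMonoid; +-comm; +-assoc; +-mono-≤; *-comm; m∸n+n≡m; m+[n∸m]≡n; <⇒≤; ≤⇒≯; ≤-refl; module ≤-Reasoning)
open import Algebra.Properties.CommutativeMonoid.Sum +-0-commutativeMonoid
  using (sum-syntax; sum-cong-≗; ∑-comm; ∑-permute)
open import Data.Product using (Σ; ∃-syntax; _×_; _,_)
open import Data.Vec using (lookup; []; _∷_)
open import Data.Vec.Properties using (lookup⇒[]=)
open import Function using (_∘_)
open import Relation.Binary.PropositionalEquality using (_≡_; refl; trans; cong; cong₂; module ≡-Reasoning)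
open import Relation.Nullary using (¬_; yes; no; contradiction)

module _ {p : ℕ} .{{_ : NonZero p}} where
  open ≡-Reasoning

  _⊖_ : 𝔽 p → 𝔽 p → 𝔽 p
  a ⊖ b = (toℕ a + (p ∸ toℕ b)) mod p

  private
    toℕ-mod : ∀ n → toℕ (n mod p) ≡ n % p
    toℕ-mod n = toℕ-fromℕ< (m%n<n n p)

    %-absorbˡ-+ : ∀ m n → (m % p + n) % p ≡ (m + n) % p
    %-absorbˡ-+ m n = begin
      (m % p + n) % p           ≡⟨ %-distribˡ-+ (m % p) n p ⟩
      (m % p % p + n % p) % p   ≡⟨ cong (λ u → (u + n % p) % p) (m%n%n≡m%n m p) ⟩
      (m % p + n % p) % p       ≡⟨ %-distribˡ-+ m n p ⟨
      (m + n) % p               ∎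

    add-add-mod : ∀ (a : 𝔽 p) u v → u + v ≡ p → ((toℕ a + u) % p + v) % p ≡ toℕ a
    add-add-mod a u v u+v≡p = begin
      ((toℕ a + u) % p + v) % p ≡⟨ %-absorbˡ-+ (toℕ a + u) v ⟩
      (toℕ a + u + v) % p       ≡⟨ cong (_% p) (trans (+-assoc (toℕ a) u v) (cong (toℕ a +_) u+v≡p)) ⟩
      (toℕ a + p) % p           ≡⟨ [m+n]%n≡m%n (toℕ a) p ⟩
      toℕ a % p                 ≡⟨ m<n⇒m%n≡m (toℕ<n a) ⟩
      toℕ a                     ∎

  ⊕-comm : ∀ (a b : 𝔽 p) → a ⊕ b ≡ b ⊕ a
  ⊕-comm a b = cong (_mod p) (+-comm (toℕ a) (toℕ b))

  ⊖-⊕-cancel : ∀ (a b : 𝔽 p) → (a ⊖ b) ⊕ b ≡ a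
  ⊖-⊕-cancel a b = toℕ-injective (begin
    toℕ ((a ⊖ b) ⊕ b)                         ≡⟨ toℕ-mod _ ⟩
    (toℕ (a ⊖ b) + toℕ b) % p                 ≡⟨ cong (λ u → (u + toℕ b) % p) (toℕ-mod _) ⟩
    ((toℕ a + (p ∸ toℕ b)) % p + toℕ b) % p   ≡⟨ add-add-mod a _ _ (m∸n+n≡m (<⇒≤ (toℕ<n b))) ⟩
    toℕ a                                     ∎)

  ⊕-⊖-cancel : ∀ (a b : 𝔽 p) → (a ⊕ b) ⊖ b ≡ a
  ⊕-⊖-cancel a b = toℕ-injective (begin
    toℕ ((a ⊕ b) ⊖ b)                         ≡⟨ toℕ-mod _ ⟩
    (toℕ (a ⊕ b) + (p ∸ toℕ b)) % p           ≡⟨ cong (λ u → (u + (p ∸ toℕ b)) % p) (toℕ-mod _) ⟩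
    ((toℕ a + toℕ b) % p + (p ∸ toℕ b)) % p   ≡⟨ add-add-mod a _ _ (m+[n∸m]≡n (<⇒≤ (toℕ<n b))) ⟩
    toℕ a                                     ∎)

  ⊖-involutive : ∀ (a b : 𝔽 p) → a ⊖ (a ⊖ b) ≡ b
  ⊖-involutive a b = begin
    a ⊖ (a ⊖ b)                 ≡⟨ cong (_⊖ (a ⊖ b)) (⊖-⊕-cancel a b) ⟨
    ((a ⊖ b) ⊕ b) ⊖ (a ⊖ b)     ≡⟨ cong (_⊖ (a ⊖ b)) (⊕-comm (a ⊖ b) b) ⟩
    (b ⊕ (a ⊖ b)) ⊖ (a ⊖ b)     ≡⟨ ⊕-⊖-cancel b (a ⊖ b) ⟩
    b                           ∎

  reflection : 𝔽 p → Permutation′ p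
  reflection a = permutation (a ⊖_) (a ⊖_) (⊖-involutive a) (⊖-involutive a)

indicator : Bool → ℕ
indicator true  = 1
indicator false = 0

∣p∣≡∑indicator : ∀ {n} (S : Subset n) → ∣ S ∣ ≡ ∑[ t < n ] indicator (lookup S t)
∣p∣≡∑indicator []          = refl
∣p∣≡∑indicator (true ∷ S)  = cong (1 +_) (∣p∣≡∑indicator S)
∣p∣≡∑indicator (false ∷ S) = ∣p∣≡∑indicator S

∑-const : ∀ n c → ∑[ i < n ] c ≡ n * c
∑-const zero    c = refl
∑-const (suc n) c = cong (c +_) (∑-const n c)

∑-mono-≤ : ∀ {n} {f g : Fin n → ℕ} → (∀ i → f i ≤ g i) → ∑[ i < n ] f i ≤ ∑[ i < n ] g i
∑-mono-≤ {zero}  f≤g = z≤n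
∑-mono-≤ {suc n} f≤g = +-mono-≤ (f≤g Fin.zero) (∑-mono-≤ (f≤g ∘ Fin.suc))

indicator≤1 : ∀ b → indicator b ≤ 1
indicator≤1 true  = ≤-refl
indicator≤1 false = z≤n

∑indicator≤n : ∀ {n} (b : Fin n → Bool) → ∑[ i < n ] indicator (b i) ≤ n
∑indicator≤n {zero}  b = z≤n
∑indicator≤n {suc n} b = +-mono-≤ (indicator≤1 (b Fin.zero)) (∑indicator≤n (b ∘ Fin.suc))

∑indicator<n : ∀ {n} (b : Fin n → Bool) → ¬ (∀ i → b i ≡ true) → ∑[ i < n ] indicator (b i) < n
∑indicator<n {zero}  b ¬all = contradiction (λ ()) ¬all
∑indicator<n {suc n} b ¬all with b Fin.zero in b₀
... | false = s≤s (∑indicator≤n (b ∘ Fin.suc))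
... | true  = s≤s (∑indicator<n (b ∘ Fin.suc) λ all → ¬all λ { Fin.zero → b₀ ; (Fin.suc i) → all i })

all-true-row : ∀ {r c k} (A : Fin r → Fin (suc c) → Bool) →
  (∀ j → ∑[ i < r ] indicator (A i j) ≡ k) → c * r < suc c * k →
  ∃[ i ] (∀ j → A i j ≡ true)
all-true-row {r} {c} {k} A columns≡k c*r<[1+c]k with any? (λ i → all? (λ j → A i j ≟ true))
... | yes row = row
... | no ¬row = contradiction c*r<[1+c]k (≤⇒≯ incidences≤c*r)
  where
  open ≤-Reasoning
  incidences≤c*r : suc c * k ≤ c * r
  incidences≤c*r = begin
    suc c * k                                     ≡⟨ ∑-const (suc c) k ⟨
    ∑[ j < suc c ] k                              ≡⟨ sum-cong-≗ columns≡k ⟨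
    ∑[ j < suc c ] ∑[ i < r ] indicator (A i j)   ≡⟨ ∑-comm (λ i j → indicator (A i j)) ⟨
    ∑[ i < r ] ∑[ j < suc c ] indicator (A i j)   ≤⟨ ∑-mono-≤ (λ i → s≤s⁻¹ (∑indicator<n (A i) (¬row ∘ (i ,_)))) ⟩
    ∑[ i < r ] c                                  ≡⟨ ∑-const r c ⟩
    r * c                                         ≡⟨ *-comm r c ⟩
    c * r                                         ∎

module _ {p : ℕ} .{{_ : NonZero p}} {m : ℕ} (y : Fin m → 𝔽 p) where

  fibre-coordinate : Fin (suc m) → Permutation′ p
  fibre-coordinate i with view i
  ... | ‵fromℕ     = id
  ... | ‵inject₁ j = reflection (y j)

  fibre : 𝔽 p → Fin (suc m) → 𝔽 p
  fibre t i = fibre-coordinate i ⟨$⟩ʳ t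

  fibre-inject₁ : ∀ t j → fibre t (inject₁ j) ≡ y j ⊖ t
  fibre-inject₁ t j rewrite view-inject₁ j = refl

  fibre-fromℕ : ∀ t → fibre t (fromℕ m) ≡ t
  fibre-fromℕ t rewrite view-fromℕ m = refl

  L-fibre : ∀ t j → L m (fibre t) j ≡ y j
  L-fibre t j = begin
    fibre t (inject₁ j) ⊕ fibre t (fromℕ m) ≡⟨ cong₂ _⊕_ (fibre-inject₁ t j) (fibre-fromℕ t) ⟩
    (y j ⊖ t) ⊕ t                          ≡⟨ ⊖-⊕-cancel (y j) t ⟩
    y j                                    ∎
    where open ≡-Reasoning

theorem3 : (p : ℕ) .{{_ : NonZero p}} → Prime p → (m : ℕ) → 1 ≤ m →
    (k : ℕ) → (S : Fin (suc m) → Subset p) → (∀ i → ∣ S i ∣ ≡ k) →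
    m * p < suc m * k →
    (y : Fin m → 𝔽 p) →
    Σ (Fin (suc m) → 𝔽 p) (λ x → ((i : Fin (suc m)) → x i ∈ S i) × ((j : Fin m) → L m x j ≡ y j))
theorem3 p _ m _ k S ∣Sᵢ∣≡k m*p<[1+m]k y =
  let t , fibre-t∈S = all-true-row fibre∈S column-sum m*p<[1+m]k
  in fibre y t , (λ i → lookup⇒[]= _ _ (fibre-t∈S i)) , L-fibre y t
  where
  fibre∈S : 𝔽 p → Fin (suc m) → Bool
  fibre∈S t i = lookup (S i) (fibre y t i)

  column-sum : ∀ i → ∑[ t < p ] indicator (fibre∈S t i) ≡ k
  column-sum i = begin
    ∑[ t < p ] indicator (lookup (S i) (fibre-coordinate y i ⟨$⟩ʳ t))
      ≡⟨ ∑-permute (indicator ∘ lookup (S i)) (fibre-coordinate y i) ⟨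
    ∑[ t < p ] indicator (lookup (S i) t)  ≡⟨ ∣p∣≡∑indicator (S i) ⟨
    ∣ S i ∣                                ≡⟨ ∣Sᵢ∣≡k i ⟩
    k                                      ∎
    where open ≡-Reasoning
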